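{- Let $m$ and $n$ be odd integers greater than $6$. Let $g_1,\dots,g_n \colon \{0,1\}^m \to \{0,1\}$ be functions in $L$, put $\mathbf{g} = (g_1,\dots,g_n) \colon \{0,1\}^m \to \{0,1\}^n$ and $\varphi = \beta_n \circ \mathbf{g}$, and assume that $\mathbf{c} := \mathbf{g}(0,\dots,0) \in \beta_n^{ -1}(0)$ and that $\beta_m(\mathbf{a}) \leq \varphi(\mathbf{a})$ for all $\mathbf{a} \in \{0,1\}^m$. Then $m = n$.
   Context: $L$ is the set of Boolean functions of the form $(x_1,\dots,x_m) \mapsto x_{i_1}+\dots+x_{i_k}+c$ (addition modulo 2, $c \in \{0,1\}$), i.e. the clone generated by $+$ and the constant $1$. For $k \geq 1$, $\beta_k \colon \{0,1\}^k \to \{0,1\}$ is defined by $\beta_k(\mathbf{a}) = 1$ iff the Hamming weight of $\mathbf{a}$ (number of entries equal to 1) belongs to $\{1,2,k\}$. -}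

module Defs where

open import Data.Bool using (Bool; true; false; _xor_; _∧_)
open import Data.Nat using (ℕ; zero; suc; _%_)
open import Data.Fin using (Fin)
open import Data.Vec using (Vec; []; _∷_; lookup; replicate; foldr; zipWith; map)
open import Data.Product using (Σ; _×_; ∃)
open import Relation.Binary.PropositionalEquality using (_≡_)

-- A Boolean vector {0,1}^m, with 0 = false and 1 = true.
BVec : ℕ → Set
BVec m = Vec Bool m

Odd : ℕ → Set
Odd m = m % 2 ≡ 1

weight : ∀ {k} → BVec k → ℕ
weight []          = 0
weight (true  ∷ a) = suc (weight a)
weight (false ∷ a) = weight a

parity : ∀ {k} → BVec k → Bool
parity = foldr (λ _ → Bool) _xor_ false

affine : ∀ {m} → BVec m → Bool → BVec m → Bool
affine sel c x = c xor parity (zipWith _∧_ sel x)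

-- membership in the clone L: f is of the form x_{i1}+…+x_{ik}+c
InL : ∀ {m} → (BVec m → Bool) → Set
InL {m} f = Σ (BVec m) λ sel → Σ Bool λ c → ∀ x → f x ≡ affine sel c x

isOneTwo : ℕ → Bool
isOneTwo 1 = true
isOneTwo 2 = true
isOneTwo _ = false

open import Data.Nat using (_≡ᵇ_)
open import Data.Bool using (_∨_)

β : (k : ℕ) → BVec k → Bool
β k a = isOneTwo (weight a) ∨ (weight a ≡ᵇ k)

data _≤B_ : Bool → Bool → Set where
  f≤b : ∀ {b} → false ≤B b
  t≤t : true ≤B true

-- Put c = 𝐠(0) and u_j = 𝐠(e_j).  As 𝐠 is affine, 𝐠(e_j + e_k) = c + u_j + u_k, so testing
-- β_m ≤ φ on the inputs of weight 1, 2 and m shows that every u_j, every c + u_j + u_k (j ≠ k)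
-- and 𝐠(1,…,1) has weight in {1, 2, n}, whereas c has not.  Since n ≥ 7, no weight in 3 … n − 1
-- is allowed, and this makes the u_j rigid.
--
-- If c ≠ 0, then |c| ≥ 3 and the u_j are distinct.  Take i with |u_i| ≤ 2 and Y = c + u_i.  If
-- |Y| ≥ 5, each other u_j is 1 or Y + 1: too few values for m − 1 ≥ 6 distinct vectors.  If
-- 3 ≤ |Y| ≤ 4, the other u_j lie within distance 2 of both 0 and Y, a set of six vectors, which
-- they therefore fill; two of them then give c + u_k + u_l = u_i + e_a + e_b of weight 3 or 4.
-- If no such i exists, then |c| ≤ 4 and all m ≥ 7 vectors u_j lie in the six-element set built
-- from c in the same way (unless some u_i = 1, which forces a complement of weight n − 1 or n − 2).
--
-- If c = 0, the u_j are distinct vectors of weight 1 or 2 at pairwise distance at most 2, hence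
-- a star: removing a common point z (or nothing) leaves vectors of weight at most 1.  So
-- 𝐠(1,…,1) = Σ u_j has weight m − 1, m or m + 1; this weight is n, and m, n are odd.
module Submission where

open import Defs
open import Algebra.Bundles using (CommutativeMonoid; CommutativeRing)
import Algebra.Properties.CommutativeMonoid.Sum as CommutativeMonoidSum
import Algebra.Properties.CommutativeSemigroup as CommutativeSemigroupProperties
open import Data.Bool using (Bool; true; false; _xor_; _∨_; not)
open import Data.Bool.Properties
  using (¬-not; ∧-distribˡ-xor; xor-∧-commutativeRing; xor-assoc; xor-comm; xor-identityˡ;
         xor-identityʳ; xor-same; ∨-zeroʳ; T-≡)
  renaming (_≟_ to _≟ᴮ_)
open import Data.Empty using (⊥; ⊥-elim)
open import Data.Fin using (Fin; zero; suc; _≟_; punchIn; fromℕ<)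
open import Data.Fin.Properties
  using (any?; all?; ¬∀⟶∃¬; injective⇒≤; 0≢1+n; punchIn-injective; punchInᵢ≢i)
import Data.Fin.Properties as Fin
open import Data.Fin.Subset using (⁅_⁆; _∩_; _─_)
open import Data.Fin.Subset.Properties using (x∈⁅x⁆; x≢y⇒x∉⁅y⁆; ∩-comm)
open import Data.List using (List; []; _∷_; length; _++_) renaming (lookup to lookupᴸ; map to mapᴸ)
open import Data.List.Membership.Propositional using (_∈_; _∉_)
open import Data.List.Membership.Propositional.Properties using (∈-map⁺; ∈-++⁺ˡ; ∈-++⁺ʳ)
import Data.List.Relation.Unary.Any as Any
open import Data.List.Relation.Unary.Any using (here; there; index)
open import Data.List.Relation.Unary.Any.Properties using (lookup-index)
open import Data.Nat using (ℕ; zero; suc; _+_; _*_; _≤_; _<_; z≤n; s≤s; _≡ᵇ_; _≤?_; _%_)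
  renaming (_≟_ to _≟ℕ_)
open import Data.Nat.DivMod using (%-distribˡ-+)
open import Data.Nat.Properties
  using (+-suc; +-mono-≤; +-monoʳ-≤; +-cancelˡ-≡; +-cancelʳ-≤; ≤-trans; ≤-refl;
         ≤-reflexive; ≤-antisym; ≤-pred; ≤∧≢⇒<; ≰⇒>; n≤0⇒n≡0; n≤1+n; n≢0⇒n>0; m≤n+m; m≤m+n;
         m≤n⇒m≤1+n; m<m+n; *-monoʳ-≤; suc-injective; 1+n≰n; <-irrefl; <⇒≱; <-cmp; ≡ᵇ⇒≡; ≡⇒≡ᵇ)
open import Data.Nat.Tactic.RingSolver using (solve-∀)
open import Data.Product using (∃; ∃₂; _×_; _,_; proj₁; proj₂)
open import Data.Sum using (_⊎_; inj₁; inj₂; swap)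
open import Data.Vec using (Vec; []; _∷_; lookup; replicate; zipWith; tabulate)
open import Data.Vec.Functional using () renaming (_∷_ to _∷ᶠ_)
open import Data.Vec.Properties
  using (zipWith-assoc; zipWith-comm; zipWith-identityˡ; zipWith-identityʳ; zipWith-inverseʳ;
         zipWith-distribˡ; map-id; ≡-dec; lookup-zipWith; lookup-replicate; []=⇒lookup; lookup⇒[]=;
         tabulate∘lookup; tabulate-cong; lookup∘tabulate)
open import Function using (_∘_; Equivalence)
open import Function.Definitions using (Injective)
open import Level using (0ℓ)
open import Relation.Binary using (DecidableEquality; tri<; tri≈; tri>)
open import Relation.Binary.PropositionalEquality
  using (_≡_; _≢_; refl; sym; trans; cong; cong₂; subst; module ≡-Reasoning)
open import Relation.Binary.PropositionalEquality.Algebra using (isMagma)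
open import Relation.Nullary using (¬_; Dec; yes; no)
open import Relation.Nullary.Decidable using (_×-dec_)

infixl 6 _⊕_

_⊕_ : ∀ {n} → BVec n → BVec n → BVec n
_⊕_ = zipWith _xor_

𝟘 𝟙 : ∀ {n} → BVec n
𝟘 = replicate _ false
𝟙 = replicate _ true

module _ {n : ℕ} where

  ⊕-assoc : (x y z : BVec n) → x ⊕ y ⊕ z ≡ x ⊕ (y ⊕ z)
  ⊕-assoc = zipWith-assoc xor-assoc

  ⊕-comm : (x y : BVec n) → x ⊕ y ≡ y ⊕ x
  ⊕-comm = zipWith-comm xor-comm

  ⊕-identityˡ : (x : BVec n) → 𝟘 ⊕ x ≡ x
  ⊕-identityˡ = zipWith-identityˡ xor-identityˡ

  ⊕-identityʳ : (x : BVec n) → x ⊕ 𝟘 ≡ x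
  ⊕-identityʳ = zipWith-identityʳ xor-identityʳ

  ⊕-self : (x : BVec n) → x ⊕ x ≡ 𝟘
  ⊕-self x = trans (cong (x ⊕_) (sym (map-id x))) (zipWith-inverseʳ xor-same x)

  [x⊕y]⊕y≡x : (x y : BVec n) → x ⊕ y ⊕ y ≡ x
  [x⊕y]⊕y≡x x y = trans (⊕-assoc x y y) (trans (cong (x ⊕_) (⊕-self y)) (⊕-identityʳ x))

  x⊕[x⊕y]≡y : (x y : BVec n) → x ⊕ (x ⊕ y) ≡ y
  x⊕[x⊕y]≡y x y = trans (sym (⊕-assoc x x y)) (trans (cong (_⊕ y) (⊕-self x)) (⊕-identityˡ y))

  ⊕-cancelˡ : (x : BVec n) {y z : BVec n} → x ⊕ y ≡ x ⊕ z → y ≡ z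
  ⊕-cancelˡ x {y} {z} eq = trans (sym (x⊕[x⊕y]≡y x y)) (trans (cong (x ⊕_) eq) (x⊕[x⊕y]≡y x z))

  ⊕-cancelʳ : (x : BVec n) {y z : BVec n} → y ⊕ x ≡ z ⊕ x → y ≡ z
  ⊕-cancelʳ x {y} {z} eq = trans (sym ([x⊕y]⊕y≡x y x)) (trans (cong (_⊕ x) eq) ([x⊕y]⊕y≡x z x))

  x⊕y≡z⇒y≡x⊕z : {x y z : BVec n} → x ⊕ y ≡ z → y ≡ x ⊕ z
  x⊕y≡z⇒y≡x⊕z {x} {y} x⊕y≡z = trans (sym (x⊕[x⊕y]≡y x y)) (cong (x ⊕_) x⊕y≡z)

  x⊕y≡𝟘⇒x≡y : {x y : BVec n} → x ⊕ y ≡ 𝟘 → x ≡ y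
  x⊕y≡𝟘⇒x≡y {x} {y} x⊕y≡𝟘 = trans (sym ([x⊕y]⊕y≡x x y)) (trans (cong (_⊕ y) x⊕y≡𝟘) (⊕-identityˡ y))

⊕-commutativeMonoid : ℕ → CommutativeMonoid 0ℓ 0ℓ
⊕-commutativeMonoid n = record
  { Carrier             = BVec n
  ; _≈_                 = _≡_
  ; _∙_                 = _⊕_
  ; ε                   = 𝟘
  ; isCommutativeMonoid = record
    { isMonoid = record
      { isSemigroup = record { isMagma = isMagma _⊕_ ; assoc = ⊕-assoc }
      ; identity    = ⊕-identityˡ , ⊕-identityʳ
      }
    ; comm     = ⊕-comm
    }
  }

module ⊕-Properties {n : ℕ} =
  CommutativeSemigroupProperties (CommutativeMonoid.commutativeSemigroup (⊕-commutativeMonoid n))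

module xor-Properties =
  CommutativeSemigroupProperties (CommutativeRing.+-commutativeSemigroup xor-∧-commutativeRing)

[x⊕z]⊕[y⊕z]≡x⊕y : ∀ {n} (x y z : BVec n) → (x ⊕ z) ⊕ (y ⊕ z) ≡ x ⊕ y
[x⊕z]⊕[y⊕z]≡x⊕y x y z =
  trans (⊕-Properties.interchange x z y z) (trans (cong (x ⊕ y ⊕_) (⊕-self z)) (⊕-identityʳ (x ⊕ y)))

module _ {n : ℕ} where

  lookup-ext : {x y : BVec n} → (∀ i → lookup x i ≡ lookup y i) → x ≡ y
  lookup-ext {x} {y} eq = trans (sym (tabulate∘lookup x)) (trans (tabulate-cong eq) (tabulate∘lookup y))

  lookup-⊕ : (x y : BVec n) (i : Fin n) → lookup (x ⊕ y) i ≡ lookup x i xor lookup y i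
  lookup-⊕ x y i = lookup-zipWith _xor_ i x y

  lookup-𝟘 : (i : Fin n) → lookup (𝟘 {n}) i ≡ false
  lookup-𝟘 i = lookup-replicate i false

  lookup-⁅⁆-self : (i : Fin n) → lookup ⁅ i ⁆ i ≡ true
  lookup-⁅⁆-self i = []=⇒lookup (x∈⁅x⁆ i)

  lookup-⁅⁆-other : {i j : Fin n} → i ≢ j → lookup ⁅ i ⁆ j ≡ false
  lookup-⁅⁆-other {i} {j} i≢j with lookup ⁅ i ⁆ j in eq
  ... | false = refl
  ... | true  = ⊥-elim (x≢y⇒x∉⁅y⁆ (i≢j ∘ sym) (lookup⇒[]= j ⁅ i ⁆ eq))

  lookup-⊕-⁅⁆-self : (x : BVec n) (a : Fin n) → lookup (x ⊕ ⁅ a ⁆) a ≡ not (lookup x a)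
  lookup-⊕-⁅⁆-self x a rewrite lookup-⊕ x ⁅ a ⁆ a | lookup-⁅⁆-self a = xor-comm (lookup x a) true

  lookup-⊕-⁅⁆-other : (x : BVec n) {a b : Fin n} → a ≢ b → lookup (x ⊕ ⁅ a ⁆) b ≡ lookup x b
  lookup-⊕-⁅⁆-other x {a} {b} a≢b rewrite lookup-⊕ x ⁅ a ⁆ b | lookup-⁅⁆-other a≢b = xor-identityʳ _

lookup-─ : ∀ {n} (x y : BVec n) (i : Fin n) →
           lookup (x ─ y) i ≡ true → lookup x i ≡ true × lookup y i ≡ false
lookup-─ (_ ∷ _) (false ∷ _) zero    xi = xi , refl
lookup-─ (_ ∷ x) (_     ∷ y) (suc i) eq = lookup-─ x y i eq

weight-𝟘 : ∀ n → weight (𝟘 {n}) ≡ 0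
weight-𝟘 zero    = refl
weight-𝟘 (suc n) = weight-𝟘 n

weight-𝟙 : ∀ n → weight (𝟙 {n}) ≡ n
weight-𝟙 zero    = refl
weight-𝟙 (suc n) = cong suc (weight-𝟙 n)

weight-⁅⁆ : ∀ {n} (p : Fin n) → weight ⁅ p ⁆ ≡ 1
weight-⁅⁆ {suc n} zero = cong suc (weight-𝟘 n)
weight-⁅⁆ (suc p)      = weight-⁅⁆ p

weight-≤ : ∀ {n} (x : BVec n) → weight x ≤ n
weight-≤ []          = z≤n
weight-≤ (true  ∷ x) = s≤s (weight-≤ x)
weight-≤ (false ∷ x) = m≤n⇒m≤1+n (weight-≤ x)

weight≡0⇒≡𝟘 : ∀ {n} (x : BVec n) → weight x ≡ 0 → x ≡ 𝟘
weight≡0⇒≡𝟘 []          _ = refl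
weight≡0⇒≡𝟘 (false ∷ x) w = cong (false ∷_) (weight≡0⇒≡𝟘 x w)

weight≡n⇒≡𝟙 : ∀ {n} (x : BVec n) → weight x ≡ n → x ≡ 𝟙
weight≡n⇒≡𝟙 []                  _ = refl
weight≡n⇒≡𝟙 (true  ∷ x)         w = cong (true ∷_) (weight≡n⇒≡𝟙 x (suc-injective w))
weight≡n⇒≡𝟙 {suc n} (false ∷ x) w = ⊥-elim (1+n≰n (subst (_≤ n) w (weight-≤ x)))

weight-⊕-𝟙 : ∀ {n} (x : BVec n) → weight (x ⊕ 𝟙) + weight x ≡ n
weight-⊕-𝟙 []          = refl
weight-⊕-𝟙 (true  ∷ x) = trans (+-suc _ _) (cong suc (weight-⊕-𝟙 x))
weight-⊕-𝟙 (false ∷ x) = cong suc (weight-⊕-𝟙 x)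

weight-∩-─ : ∀ {n} (x y : BVec n) → weight x ≡ weight (x ∩ y) + weight (x ─ y)
weight-∩-─ []          []          = refl
weight-∩-─ (true  ∷ x) (true  ∷ y) = cong suc (weight-∩-─ x y)
weight-∩-─ (true  ∷ x) (false ∷ y) = trans (cong suc (weight-∩-─ x y)) (sym (+-suc _ _))
weight-∩-─ (false ∷ x) (true  ∷ y) = weight-∩-─ x y
weight-∩-─ (false ∷ x) (false ∷ y) = weight-∩-─ x y

weight-⊕-─ : ∀ {n} (x y : BVec n) → weight (x ⊕ y) ≡ weight (x ─ y) + weight (y ─ x)
weight-⊕-─ []          []          = refl
weight-⊕-─ (true  ∷ x) (true  ∷ y) = weight-⊕-─ x y
weight-⊕-─ (true  ∷ x) (false ∷ y) = cong suc (weight-⊕-─ x y)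
weight-⊕-─ (false ∷ x) (true  ∷ y) = trans (cong suc (weight-⊕-─ x y)) (sym (+-suc _ _))
weight-⊕-─ (false ∷ x) (false ∷ y) = weight-⊕-─ x y

weight-⊕-∩ : ∀ {n} (x y : BVec n) → weight x + weight y ≡ weight (x ⊕ y) + 2 * weight (x ∩ y)
weight-⊕-∩ x y = begin
  weight x + weight y     ≡⟨ cong₂ _+_ (weight-∩-─ x y) y≡r+q ⟩
  (r + p) + (r + q)       ≡⟨ rearrange r p q ⟩
  (p + q) + 2 * r         ≡⟨ cong (_+ 2 * r) (weight-⊕-─ x y) ⟨
  weight (x ⊕ y) + 2 * r  ∎
  where
  open ≡-Reasoning
  r = weight (x ∩ y)
  p = weight (x ─ y)
  q = weight (y ─ x)
  y≡r+q : weight y ≡ r + q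
  y≡r+q = trans (weight-∩-─ y x) (cong (λ v → weight v + q) (∩-comm y x))
  rearrange : ∀ r p q → (r + p) + (r + q) ≡ (p + q) + 2 * r
  rearrange = solve-∀

weight-─-≤ : ∀ {n} (x y : BVec n) → weight (x ─ y) ≤ weight x
weight-─-≤ x y = subst (weight (x ─ y) ≤_) (sym (weight-∩-─ x y)) (m≤n+m _ _)

weight-⊕-≤ : ∀ {n} (x y : BVec n) → weight (x ⊕ y) ≤ weight x + weight y
weight-⊕-≤ x y = subst (_≤ weight x + weight y) (sym (weight-⊕-─ x y))
                       (+-mono-≤ (weight-─-≤ x y) (weight-─-≤ y x))

weight-≤-⊕ : ∀ {n} (x y : BVec n) → weight x ≤ weight (x ⊕ y) + weight y
weight-≤-⊕ x y =
  subst (λ v → weight v ≤ weight (x ⊕ y) + weight y) ([x⊕y]⊕y≡x x y) (weight-⊕-≤ (x ⊕ y) y)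

Disjoint : ∀ {n} → BVec n → BVec n → Set
Disjoint x y = ∀ i → lookup x i ≡ true → lookup y i ≡ false

weight-⊕-disjoint : ∀ {n} (x y : BVec n) → Disjoint x y → weight (x ⊕ y) ≡ weight x + weight y
weight-⊕-disjoint []          []          _ = refl
weight-⊕-disjoint (true  ∷ x) (true  ∷ y) d with () ← d zero refl
weight-⊕-disjoint (true  ∷ x) (false ∷ y) d = cong suc (weight-⊕-disjoint x y (d ∘ suc))
weight-⊕-disjoint (false ∷ x) (true  ∷ y) d =
  trans (cong suc (weight-⊕-disjoint x y (d ∘ suc))) (sym (+-suc _ _))
weight-⊕-disjoint (false ∷ x) (false ∷ y) d = weight-⊕-disjoint x y (d ∘ suc)

position : ∀ {n} (x : BVec n) → 1 ≤ weight x → ∃ λ p → lookup x p ≡ true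
position (true  ∷ x) _ = zero , refl
position (false ∷ x) w = let p , xp = position x w in suc p , xp

module _ {n : ℕ} where

  𝟘-disjoint : (y : BVec n) → Disjoint 𝟘 y
  𝟘-disjoint _ i 𝟘i with () ← trans (sym (lookup-𝟘 i)) 𝟘i

  ⁅⁆-disjoint : (x : BVec n) {z : Fin n} → lookup x z ≡ false → Disjoint ⁅ z ⁆ x
  ⁅⁆-disjoint x {z} xz i zi with z ≟ i
  ... | yes refl = xz
  ... | no  z≢i with () ← trans (sym zi) (lookup-⁅⁆-other z≢i)

  weight-⊕-⁅⁆-∉ : (x : BVec n) {p : Fin n} → lookup x p ≡ false → weight (x ⊕ ⁅ p ⁆) ≡ suc (weight x)
  weight-⊕-⁅⁆-∉ x {p} xp = begin
    weight (x ⊕ ⁅ p ⁆)        ≡⟨ cong weight (⊕-comm x ⁅ p ⁆) ⟩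
    weight (⁅ p ⁆ ⊕ x)        ≡⟨ weight-⊕-disjoint ⁅ p ⁆ x (⁅⁆-disjoint x xp) ⟩
    weight ⁅ p ⁆ + weight x   ≡⟨ cong (_+ weight x) (weight-⁅⁆ p) ⟩
    suc (weight x)            ∎
    where open ≡-Reasoning

  weight-⊕-⁅⁆-∈ : (x : BVec n) {p : Fin n} → lookup x p ≡ true → suc (weight (x ⊕ ⁅ p ⁆)) ≡ weight x
  weight-⊕-⁅⁆-∈ x {p} xp = begin
    suc (weight (x ⊕ ⁅ p ⁆))     ≡⟨ weight-⊕-⁅⁆-∉ (x ⊕ ⁅ p ⁆) (trans (lookup-⊕-⁅⁆-self x p) (cong not xp))
                                  ⟨
    weight (x ⊕ ⁅ p ⁆ ⊕ ⁅ p ⁆)   ≡⟨ cong weight ([x⊕y]⊕y≡x x ⁅ p ⁆) ⟩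
    weight x                     ∎
    where open ≡-Reasoning

  module _ {a b : Fin n} (a≢b : a ≢ b) where

    weight-⊕-pair-∉ : (x : BVec n) → lookup x a ≡ false → lookup x b ≡ false →
                      weight (x ⊕ (⁅ a ⁆ ⊕ ⁅ b ⁆)) ≡ 2 + weight x
    weight-⊕-pair-∉ x xa xb = begin
      weight (x ⊕ (⁅ a ⁆ ⊕ ⁅ b ⁆))  ≡⟨ cong weight (⊕-assoc x ⁅ a ⁆ ⁅ b ⁆) ⟨
      weight (x ⊕ ⁅ a ⁆ ⊕ ⁅ b ⁆)    ≡⟨ weight-⊕-⁅⁆-∉ (x ⊕ ⁅ a ⁆) (trans (lookup-⊕-⁅⁆-other x a≢b) xb) ⟩
      suc (weight (x ⊕ ⁅ a ⁆))      ≡⟨ cong suc (weight-⊕-⁅⁆-∉ x xa) ⟩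
      2 + weight x                  ∎
      where open ≡-Reasoning

    weight-⊕-pair-∈ : (x : BVec n) → lookup x a ≡ true → lookup x b ≡ true →
                      2 + weight (x ⊕ (⁅ a ⁆ ⊕ ⁅ b ⁆)) ≡ weight x
    weight-⊕-pair-∈ x xa xb = begin
      2 + weight (x ⊕ (⁅ a ⁆ ⊕ ⁅ b ⁆))  ≡⟨ cong (λ v → 2 + weight v) (⊕-assoc x ⁅ a ⁆ ⁅ b ⁆) ⟨
      2 + weight (x ⊕ ⁅ a ⁆ ⊕ ⁅ b ⁆)    ≡⟨ cong suc (weight-⊕-⁅⁆-∈ (x ⊕ ⁅ a ⁆) x⊕a∋b) ⟩
      suc (weight (x ⊕ ⁅ a ⁆))          ≡⟨ weight-⊕-⁅⁆-∈ x xa ⟩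
      weight x                          ∎
      where
      open ≡-Reasoning
      x⊕a∋b = trans (lookup-⊕-⁅⁆-other x a≢b) xb

    weight-pair : weight (⁅ a ⁆ ⊕ ⁅ b ⁆) ≡ 2
    weight-pair = begin
      weight (⁅ a ⁆ ⊕ ⁅ b ⁆)       ≡⟨ cong weight (⊕-identityˡ (⁅ a ⁆ ⊕ ⁅ b ⁆)) ⟨
      weight (𝟘 ⊕ (⁅ a ⁆ ⊕ ⁅ b ⁆)) ≡⟨ weight-⊕-pair-∉ 𝟘 (lookup-𝟘 a) (lookup-𝟘 b) ⟩
      2 + weight (𝟘 {n})           ≡⟨ cong (2 +_) (weight-𝟘 n) ⟩
      2                            ∎
      where open ≡-Reasoning

    lookup-pair-left : lookup (⁅ a ⁆ ⊕ ⁅ b ⁆) a ≡ true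
    lookup-pair-left = trans (lookup-⊕-⁅⁆-other ⁅ a ⁆ (a≢b ∘ sym)) (lookup-⁅⁆-self a)

    lookup-pair-right : lookup (⁅ a ⁆ ⊕ ⁅ b ⁆) b ≡ true
    lookup-pair-right = trans (lookup-⊕-⁅⁆-self ⁅ a ⁆ b) (cong not (lookup-⁅⁆-other a≢b))

    lookup-pair-other : ∀ {w} → a ≢ w → b ≢ w → lookup (⁅ a ⁆ ⊕ ⁅ b ⁆) w ≡ false
    lookup-pair-other a≢w b≢w = trans (lookup-⊕-⁅⁆-other ⁅ a ⁆ b≢w) (lookup-⁅⁆-other a≢w)

    ≡pair : (x : BVec n) → weight x ≤ 2 → lookup x a ≡ true → lookup x b ≡ true → x ≡ ⁅ a ⁆ ⊕ ⁅ b ⁆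
    ≡pair x x≤2 xa xb = x⊕y≡𝟘⇒x≡y (weight≡0⇒≡𝟘 _ (n≤0⇒n≡0 (≤-pred (≤-pred
      (subst (_≤ 2) (sym (weight-⊕-pair-∈ x xa xb)) x≤2)))))

  ≡⁅⁆ : (x : BVec n) {a : Fin n} → weight x ≤ 1 → lookup x a ≡ true → x ≡ ⁅ a ⁆
  ≡⁅⁆ x x≤1 xa = x⊕y≡𝟘⇒x≡y (weight≡0⇒≡𝟘 _ (n≤0⇒n≡0 (≤-pred
    (subst (_≤ 1) (sym (weight-⊕-⁅⁆-∈ x xa)) x≤1))))

  two-positions : (x : BVec n) → 2 ≤ weight x →
                  ∃₂ λ a b → a ≢ b × lookup x a ≡ true × lookup x b ≡ true
  two-positions x 2≤x
    with a , xa ← position x (≤-trans (s≤s z≤n) 2≤x)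
    with b , x′b ← position (x ⊕ ⁅ a ⁆) (≤-pred (subst (2 ≤_) (sym (weight-⊕-⁅⁆-∈ x xa)) 2≤x))
    = a , b , a≢b , xa , trans (sym (lookup-⊕-⁅⁆-other x a≢b)) x′b
    where
    a≢b : a ≢ b
    a≢b refl with () ← trans (sym x′b) (trans (lookup-⊕-⁅⁆-self x a) (cong not xa))

  light-disjoint : (x y : BVec n) → weight x ≤ 1 → weight y ≤ 1 → x ≢ y → Disjoint x y
  light-disjoint x y x≤1 y≤1 x≢y i xi with lookup y i in yi
  ... | false = refl
  ... | true  = ⊥-elim (x≢y (trans (≡⁅⁆ x x≤1 xi) (sym (≡⁅⁆ y y≤1 yi))))

private
  two≤outside : ∀ r p q → 3 ≤ r + p → r + q ≤ 2 → 3 ≤ p + q → 2 ≤ p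
  two≤outside r       0             q _          r+q≤2 3≤q   =
    ⊥-elim (<-irrefl refl (≤-trans 3≤q (≤-trans (m≤n+m q r) r+q≤2)))
  two≤outside zero    1             q (s≤s ())   _     _
  two≤outside (suc r) 1             q _          r+q≤2 3≤1+q =
    ⊥-elim (<-irrefl refl (≤-trans (≤-pred 3≤1+q) (≤-trans (m≤n+m q r) (≤-pred r+q≤2))))
  two≤outside r       (suc (suc p)) q _          _     _     = s≤s (s≤s z≤n)

two-positions-outside : ∀ {n} (Y u : BVec n) → 3 ≤ weight Y → weight u ≤ 2 → 3 ≤ weight (Y ⊕ u) →
                        ∃₂ λ a b → a ≢ b × (lookup Y a ≡ true × lookup u a ≡ false)
                                         × (lookup Y b ≡ true × lookup u b ≡ false)
two-positions-outside Y u 3≤Y u≤2 3≤Y⊕u =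
  let a , b , a≢b , a∈ , b∈ = two-positions (Y ─ u) (two≤outside _ _ _ Y-split u-split Y⊕u-split)
  in  a , b , a≢b , lookup-─ Y u a a∈ , lookup-─ Y u b b∈
  where
  Y-split   = subst (3 ≤_) (weight-∩-─ Y u) 3≤Y
  u-split   = subst (_≤ 2) (trans (weight-∩-─ u Y) (cong (λ v → weight v + weight (u ─ Y)) (∩-comm u Y))) u≤2
  Y⊕u-split = subst (3 ≤_) (weight-⊕-─ Y u) 3≤Y⊕u

data βWeight (n : ℕ) : ℕ → Set where
  one  : βWeight n 1
  two  : βWeight n 2
  full : βWeight n n

βWeight-cases : ∀ {n w} → βWeight n w → (1 ≤ w × w ≤ 2) ⊎ w ≡ n
βWeight-cases one  = inj₁ (≤-refl , s≤s z≤n)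
βWeight-cases two  = inj₁ (s≤s z≤n , ≤-refl)
βWeight-cases full = inj₂ refl

βWeight-gap : ∀ {n w} → 3 ≤ w → w < n → ¬ βWeight n w
βWeight-gap 3≤w w<n βw with βWeight-cases βw
... | inj₁ (_ , w≤2) = <-irrefl refl (≤-trans 3≤w w≤2)
... | inj₂ refl      = <-irrefl refl w<n

βWeight-pos : ∀ {n w} → 1 ≤ n → βWeight n w → 1 ≤ w
βWeight-pos 1≤n βw with βWeight-cases βw
... | inj₁ (1≤w , _) = 1≤w
... | inj₂ refl      = 1≤n

β⇒βWeight : ∀ {k} (a : BVec k) → β k a ≡ true → βWeight k (weight a)
β⇒βWeight {k} a = classify (weight a)
  where
  full-if : ∀ w → (w ≡ᵇ k) ≡ true → βWeight k w
  full-if w eq = subst (βWeight k) (sym (≡ᵇ⇒≡ w k (Equivalence.from T-≡ eq))) full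
  classify : ∀ w → isOneTwo w ∨ (w ≡ᵇ k) ≡ true → βWeight k w
  classify 0                     = full-if 0
  classify 1                     = λ _ → one
  classify 2                     = λ _ → two
  classify w@(suc (suc (suc _))) = full-if w

βWeight⇒β : ∀ {k} (a : BVec k) → βWeight k (weight a) → β k a ≡ true
βWeight⇒β {k} a = classify
  where
  classify : ∀ {w} → βWeight k w → isOneTwo w ∨ (w ≡ᵇ k) ≡ true
  classify one  = refl
  classify two  = refl
  classify full = trans (cong (isOneTwo k ∨_) (Equivalence.to T-≡ (≡⇒≡ᵇ k k refl))) (∨-zeroʳ _)

module _ {n : ℕ} (n≥7 : 7 ≤ n) where

  complement-gap : (y : BVec n) → 1 ≤ weight y → weight y ≤ 4 → ¬ βWeight n (weight (y ⊕ 𝟙))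
  complement-gap y 1≤y y≤4 = βWeight-gap 3≤ <n
    where
    sum : weight (y ⊕ 𝟙) + weight y ≡ n
    sum = weight-⊕-𝟙 y
    3≤ : 3 ≤ weight (y ⊕ 𝟙)
    3≤ = +-cancelʳ-≤ 4 3 _ (≤-trans n≥7
           (subst (_≤ weight (y ⊕ 𝟙) + 4) sum (+-monoʳ-≤ (weight (y ⊕ 𝟙)) y≤4)))
    <n : weight (y ⊕ 𝟙) < n
    <n = subst (weight (y ⊕ 𝟙) <_) sum (m<m+n (weight (y ⊕ 𝟙)) 1≤y)

module _ {A : Set} where

  injective-into-list⇒≤ : ∀ {k} (L : List A) (f : Fin k → A) → Injective _≡_ _≡_ f →
                          (∀ j → f j ∈ L) → k ≤ length L
  injective-into-list⇒≤ L f f-inj f∈L = injective⇒≤ index∘f-injective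
    where
    open ≡-Reasoning
    index∘f-injective : Injective _≡_ _≡_ (λ j → index (f∈L j))
    index∘f-injective {j} {j′} eq = f-inj (begin
      f j                          ≡⟨ lookup-index (f∈L j) ⟩
      lookupᴸ L (index (f∈L j))    ≡⟨ cong (lookupᴸ L) eq ⟩
      lookupᴸ L (index (f∈L j′))   ≡⟨ lookup-index (f∈L j′) ⟨
      f j′                         ∎)

  injective-into-list-onto : DecidableEquality A → ∀ {k} (L : List A) (f : Fin k → A) →
                             Injective _≡_ _≡_ f → (∀ j → f j ∈ L) → length L ≤ k →
                             ∀ {a} → a ∈ L → ∃ λ j → f j ≡ a
  injective-into-list-onto _≟ᴬ_ L f f-inj f∈L L≤k {a} a∈L with any? (λ j → f j ≟ᴬ a)
  ... | yes hit  = hit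
  ... | no  miss = ⊥-elim (1+n≰n (≤-trans (injective-into-list⇒≤ L (a ∷ᶠ f) a∷f-injective a∷f∈L) L≤k))
    where
    a∷f-injective : Injective _≡_ _≡_ (a ∷ᶠ f)
    a∷f-injective {zero}  {zero}   _  = refl
    a∷f-injective {zero}  {suc j′} eq = ⊥-elim (miss (j′ , sym eq))
    a∷f-injective {suc j} {zero}   eq = ⊥-elim (miss (j , eq))
    a∷f-injective {suc j} {suc j′} eq = cong suc (f-inj eq)
    a∷f∈L : ∀ j → (a ∷ᶠ f) j ∈ L
    a∷f∈L zero    = a∈L
    a∷f∈L (suc j) = f∈L j

fresh : ∀ {m} (xs : List (Fin m)) → length xs < m → ∃ λ l → l ∉ xs
fresh {m} xs xs<m with all? (λ l → Any.any? (l ≟_) xs)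
... | yes all∈ = ⊥-elim (<⇒≱ xs<m (injective-into-list⇒≤ xs (λ l → l) (λ eq → eq) all∈))
... | no  ¬all = ¬∀⟶∃¬ m (_∈ xs) (λ l → Any.any? (l ≟_) xs) ¬all

-- Vectors within distance 2 of both 𝟘 and Y

record Between {n} (Y u : BVec n) : Set where
  constructor between
  field
    light : weight u ≤ 2
    close : weight (Y ⊕ u) ≤ 2

module _ {n : ℕ} {Y : BVec n} where

  between-flip : ∀ {u} → Between Y u → Between Y (Y ⊕ u)
  between-flip {u} (between u≤2 Y⊕u≤2) =
    between Y⊕u≤2 (subst (λ v → weight v ≤ 2) (sym (x⊕[x⊕y]≡y Y u)) u≤2)

  between-pair : ∀ {a b} → a ≢ b → lookup Y a ≡ true → lookup Y b ≡ true → weight Y ≤ 4 →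
                 Between Y (⁅ a ⁆ ⊕ ⁅ b ⁆)
  between-pair a≢b Ya Yb Y≤4 = between
    (≤-reflexive (weight-pair a≢b))
    (≤-pred (≤-pred (subst (_≤ 4) (sym (weight-⊕-pair-∈ a≢b Y Ya Yb)) Y≤4)))

  between-unless-complement : 7 ≤ n → ∀ v → 1 ≤ weight Y → weight Y ≤ 4 →
                              βWeight n (weight v) → βWeight n (weight (Y ⊕ v)) → Between Y v
  between-unless-complement n≥7 v 1≤Y Y≤4 βv βY⊕v with βWeight-cases βv | βWeight-cases βY⊕v
  ... | inj₂ v≡n | _ = ⊥-elim (complement-gap n≥7 Y 1≤Y Y≤4
    (subst (λ x → βWeight n (weight (Y ⊕ x))) (weight≡n⇒≡𝟙 v v≡n) βY⊕v))
  ... | _ | inj₂ Y⊕v≡n = ⊥-elim (complement-gap n≥7 Y 1≤Y Y≤4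
    (subst (βWeight n ∘ weight) (x⊕y≡z⇒y≡x⊕z (weight≡n⇒≡𝟙 (Y ⊕ v) Y⊕v≡n)) βv))
  ... | inj₁ (_ , v≤2) | inj₁ (_ , Y⊕v≤2) = between v≤2 Y⊕v≤2

  module _ (3≤Y : 3 ≤ weight Y) (Y≤4 : weight Y ≤ 4) where

    between-sum : ∀ {a b} → a ≢ b → lookup Y a ≡ true → lookup Y b ≡ true →
                  ∃₂ λ t₁ t₂ → Between Y t₁ × Between Y t₂ × t₁ ≢ t₂ × t₁ ⊕ t₂ ≡ Y ⊕ (⁅ a ⁆ ⊕ ⁅ b ⁆)
    between-sum {a} {b} a≢b Ya Yb
      with w , Zw ← position (Y ⊕ (⁅ a ⁆ ⊕ ⁅ b ⁆))
                      (≤-pred (≤-pred (subst (3 ≤_) (sym (weight-⊕-pair-∈ a≢b Y Ya Yb)) 3≤Y)))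
      = Y ⊕ (⁅ a ⁆ ⊕ ⁅ w ⁆) , ⁅ b ⁆ ⊕ ⁅ w ⁆ ,
        between-flip (between-pair a≢w Ya Yw Y≤4) , between-pair b≢w Yb Yw Y≤4 , t₁≢t₂ ,
        trans (⊕-assoc Y _ _) (cong (Y ⊕_) ([x⊕z]⊕[y⊕z]≡x⊕y ⁅ a ⁆ ⁅ b ⁆ ⁅ w ⁆))
      where
      open ≡-Reasoning
      a≢w : a ≢ w
      a≢w refl with () ← trans (sym Zw) (trans (lookup-⊕ Y _ a) (cong₂ _xor_ Ya (lookup-pair-left a≢b)))
      b≢w : b ≢ w
      b≢w refl with () ← trans (sym Zw) (trans (lookup-⊕ Y _ b) (cong₂ _xor_ Yb (lookup-pair-right a≢b)))
      Yw : lookup Y w ≡ true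
      Yw = begin
        lookup Y w                               ≡⟨ xor-identityʳ (lookup Y w) ⟨
        lookup Y w xor false                     ≡⟨ cong (lookup Y w xor_) (lookup-pair-other a≢b a≢w b≢w) ⟨
        lookup Y w xor lookup (⁅ a ⁆ ⊕ ⁅ b ⁆) w  ≡⟨ lookup-⊕ Y _ w ⟨
        lookup (Y ⊕ (⁅ a ⁆ ⊕ ⁅ b ⁆)) w           ≡⟨ Zw ⟩
        true                                     ∎
      t₁≢t₂ : Y ⊕ (⁅ a ⁆ ⊕ ⁅ w ⁆) ≢ ⁅ b ⁆ ⊕ ⁅ w ⁆
      t₁≢t₂ t₁≡t₂ with () ← begin
        false                                    ≡⟨ cong₂ _xor_ Yw (lookup-pair-right a≢w) ⟨
        lookup Y w xor lookup (⁅ a ⁆ ⊕ ⁅ w ⁆) w  ≡⟨ lookup-⊕ Y _ w ⟨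
        lookup (Y ⊕ (⁅ a ⁆ ⊕ ⁅ w ⁆)) w           ≡⟨ cong (λ v → lookup v w) t₁≡t₂ ⟩
        lookup (⁅ b ⁆ ⊕ ⁅ w ⁆) w                 ≡⟨ lookup-pair-right b≢w ⟩
        true                                     ∎

pivot : ∀ {n k} (Y : BVec n) → weight Y ≡ suc k → ∃ λ p → lookup Y p ≡ true
pivot Y w = position Y (subst (1 ≤_) (sym w) (s≤s z≤n))

-- The a-element subsets of the support of Y, listed by splitting on whether they contain a pivot p ∈ Y.
interval : ∀ {n} (Y : BVec n) a b → weight Y ≡ a + b → List (BVec n)
interval Y zero    b       _ = 𝟘 ∷ []
interval Y (suc a) zero    _ = Y ∷ []
interval Y (suc a) (suc b) w =
  mapᴸ (⁅ p ⁆ ⊕_) (interval (Y ⊕ ⁅ p ⁆) a (suc b) w′) ++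
  interval (Y ⊕ ⁅ p ⁆) (suc a) b (trans w′ (+-suc a b))
  where
  p = proj₁ (pivot Y w)
  w′ = suc-injective (trans (weight-⊕-⁅⁆-∈ Y (proj₂ (pivot Y w))) w)

∈-interval : ∀ {n} (Y u : BVec n) a b (w : weight Y ≡ a + b) →
             weight u ≤ a → weight (Y ⊕ u) ≤ b → u ∈ interval Y a b w
∈-interval Y u zero    b       w u≤0 _     = here (weight≡0⇒≡𝟘 u (n≤0⇒n≡0 u≤0))
∈-interval Y u (suc a) zero    w _   Y⊕u≤0 = here (sym (x⊕y≡𝟘⇒x≡y (weight≡0⇒≡𝟘 (Y ⊕ u) (n≤0⇒n≡0 Y⊕u≤0))))
∈-interval Y u (suc a) (suc b) w u≤ Y⊕u≤ = by-bit (lookup u p) refl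
  where
  p  = proj₁ (pivot Y w)
  Yp = proj₂ (pivot Y w)
  w′ = suc-injective (trans (weight-⊕-⁅⁆-∈ Y Yp) w)
  with-p    = mapᴸ (⁅ p ⁆ ⊕_) (interval (Y ⊕ ⁅ p ⁆) a (suc b) w′)
  without-p = interval (Y ⊕ ⁅ p ⁆) (suc a) b (trans w′ (+-suc a b))
  by-bit : ∀ bit → lookup u p ≡ bit → u ∈ with-p ++ without-p
  by-bit true  up = ∈-++⁺ˡ (subst (_∈ with-p) (x⊕[x⊕y]≡y ⁅ p ⁆ u)
    (∈-map⁺ (⁅ p ⁆ ⊕_) (∈-interval (Y ⊕ ⁅ p ⁆) (⁅ p ⁆ ⊕ u) a (suc b) w′ p⊕u≤ Y⊕u≤′)))
    where
    p⊕u≤ : weight (⁅ p ⁆ ⊕ u) ≤ a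
    p⊕u≤ = ≤-pred (subst (_≤ suc a)
             (trans (sym (weight-⊕-⁅⁆-∈ u up)) (cong (suc ∘ weight) (⊕-comm u ⁅ p ⁆))) u≤)
    Y⊕u≤′ : weight (Y ⊕ ⁅ p ⁆ ⊕ (⁅ p ⁆ ⊕ u)) ≤ suc b
    Y⊕u≤′ = subst (λ v → weight v ≤ suc b)
                  (sym (trans (⊕-assoc Y ⁅ p ⁆ (⁅ p ⁆ ⊕ u)) (cong (Y ⊕_) (x⊕[x⊕y]≡y ⁅ p ⁆ u)))) Y⊕u≤
  by-bit false up = ∈-++⁺ʳ with-p (∈-interval (Y ⊕ ⁅ p ⁆) u (suc a) b (trans w′ (+-suc a b)) u≤ Y⊕u≤′)
    where
    Y⊕u∋p : lookup (Y ⊕ u) p ≡ true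
    Y⊕u∋p = trans (lookup-⊕ Y u p) (cong₂ _xor_ Yp up)
    Y⊕u≤′ : weight (Y ⊕ ⁅ p ⁆ ⊕ u) ≤ b
    Y⊕u≤′ = ≤-pred (subst (_≤ suc b)
              (trans (sym (weight-⊕-⁅⁆-∈ (Y ⊕ u) Y⊕u∋p)) (cong (suc ∘ weight) (⊕-Properties.xy∙z≈xz∙y Y u ⁅ p ⁆)))
              Y⊕u≤)

private
  three-or-four : ∀ {w} → 3 ≤ w → w ≤ 4 → w ≡ 3 ⊎ w ≡ 4
  three-or-four {1} (s≤s ()) _
  three-or-four {2} (s≤s (s≤s ())) _
  three-or-four {3} _ _ = inj₁ refl
  three-or-four {4} _ _ = inj₂ refl
  three-or-four {suc (suc (suc (suc (suc _))))} _ (s≤s (s≤s (s≤s (s≤s ()))))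

  2*t≢3 : ∀ t → 2 * t ≢ 3
  2*t≢3 (suc (suc t)) eq = <-irrefl refl (≤-trans (*-monoʳ-≤ 2 {2} (s≤s (s≤s z≤n))) (≤-reflexive eq))

between-cover : ∀ {n} (Y : BVec n) → 3 ≤ weight Y → weight Y ≤ 4 →
                ∃ λ L → length L ≡ 6 × (∀ {u} → Between Y u → u ∈ L)
between-cover Y 3≤Y Y≤4 with three-or-four 3≤Y Y≤4
... | inj₁ w = interval Y 1 2 w ++ interval Y 2 1 w , refl , cover₃
  where
  cover₃ : ∀ {u} → Between Y u → u ∈ interval Y 1 2 w ++ interval Y 2 1 w
  cover₃ {u} (between u≤2 Y⊕u≤2) with weight u ≤? 1
  ... | yes u≤1 = ∈-++⁺ˡ (∈-interval Y u 1 2 w u≤1 Y⊕u≤2)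
  ... | no  u≰1 = ∈-++⁺ʳ (interval Y 1 2 w) (∈-interval Y u 2 1 w u≤2 (≤-pred (≤∧≢⇒< Y⊕u≤2 Y⊕u≢2)))
    where
    Y⊕u≢2 : weight (Y ⊕ u) ≢ 2
    Y⊕u≢2 Y⊕u≡2 = 2*t≢3 (weight (Y ∩ u)) (+-cancelˡ-≡ 2 _ _ (begin
      2 + 2 * weight (Y ∩ u)               ≡⟨ cong (_+ 2 * weight (Y ∩ u)) Y⊕u≡2 ⟨
      weight (Y ⊕ u) + 2 * weight (Y ∩ u)  ≡⟨ weight-⊕-∩ Y u ⟨
      weight Y + weight u                  ≡⟨ cong₂ _+_ w (≤-antisym u≤2 (≰⇒> u≰1)) ⟩
      5                                    ∎))
      where open ≡-Reasoning
... | inj₂ w = interval Y 2 2 w , refl , λ (between u≤2 Y⊕u≤2) → ∈-interval Y _ 2 2 w u≤2 Y⊕u≤2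

module ⊕-Sum {n : ℕ} = CommutativeMonoidSum (⊕-commutativeMonoid n)

⨁ : ∀ {k n} → (Fin k → BVec n) → BVec n
⨁ = ⊕-Sum.sum

⨁-const : ∀ {k n} (x : BVec n) → ⨁ {k} (λ _ → x) ≡ 𝟘 ⊎ ⨁ {k} (λ _ → x) ≡ x
⨁-const {zero}  x = inj₁ refl
⨁-const {suc k} x with ⨁-const {k} x
... | inj₁ eq = inj₂ (trans (cong (x ⊕_) eq) (⊕-identityʳ x))
... | inj₂ eq = inj₁ (trans (cong (x ⊕_) eq) (⊕-self x))

⨁-false∷ : ∀ {k n} (v : Fin k → BVec n) → ⨁ (λ j → false ∷ v j) ≡ false ∷ ⨁ v
⨁-false∷ {zero}  v = refl
⨁-false∷ {suc k} v = cong ((false ∷ v zero) ⊕_) (⨁-false∷ (v ∘ suc))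

⨁-⁅⁆ : ∀ m → ⨁ {m} ⁅_⁆ ≡ 𝟙
⨁-⁅⁆ zero    = refl
⨁-⁅⁆ (suc m) = begin
  ⁅ zero ⁆ ⊕ ⨁ (λ j → false ∷ ⁅ j ⁆)  ≡⟨ cong (⁅ zero ⁆ ⊕_) (⨁-false∷ ⁅_⁆) ⟩
  true ∷ (𝟘 ⊕ ⨁ ⁅_⁆)                  ≡⟨ cong (true ∷_) (trans (⊕-identityˡ _) (⨁-⁅⁆ m)) ⟩
  true ∷ 𝟙                            ∎
  where open ≡-Reasoning

⨁-homo : ∀ {m n} (G : BVec m → BVec n) → G 𝟘 ≡ 𝟘 → (∀ x y → G (x ⊕ y) ≡ G x ⊕ G y) →
         ∀ {k} (x : Fin k → BVec m) → G (⨁ x) ≡ ⨁ (G ∘ x)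
⨁-homo G G𝟘 G⊕ {zero}  x = G𝟘
⨁-homo G G𝟘 G⊕ {suc k} x =
  trans (G⊕ (x zero) (⨁ (x ∘ suc))) (cong (G (x zero) ⊕_) (⨁-homo G G𝟘 G⊕ (x ∘ suc)))

disjoint-⨁ : ∀ {k n} (x : BVec n) (w : Fin k → BVec n) → (∀ j → Disjoint x (w j)) → Disjoint x (⨁ w)
disjoint-⨁ {zero}  x w _ i _  = lookup-𝟘 i
disjoint-⨁ {suc k} x w d i xi =
  trans (lookup-⊕ (w zero) (⨁ (w ∘ suc)) i)
        (cong₂ _xor_ (d zero i xi) (disjoint-⨁ x (w ∘ suc) (d ∘ suc) i xi))

module _ {n : ℕ} where

  module _ {k : ℕ} (w : Fin (suc k) → BVec n) (w-inj : Injective _≡_ _≡_ w)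
           (light : ∀ j → weight (w j) ≤ 1) where

    weight-⨁-head : weight (⨁ w) ≡ weight (w zero) + weight (⨁ (w ∘ suc))
    weight-⨁-head = weight-⊕-disjoint (w zero) (⨁ (w ∘ suc)) (disjoint-⨁ (w zero) (w ∘ suc) λ j →
      light-disjoint (w zero) (w (suc j)) (light zero) (light (suc j)) (0≢1+n ∘ w-inj))

  weight-⨁-units : ∀ {k} (w : Fin k → BVec n) → Injective _≡_ _≡_ w → (∀ j → weight (w j) ≡ 1) →
                   weight (⨁ w) ≡ k
  weight-⨁-units {zero}  w _     _    = weight-𝟘 n
  weight-⨁-units {suc k} w w-inj unit = trans (weight-⨁-head w w-inj light)
    (cong₂ _+_ (unit zero) (weight-⨁-units (w ∘ suc) (Fin.suc-injective ∘ w-inj) (unit ∘ suc)))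
    where light = ≤-reflexive ∘ unit

  weight-⨁-light : ∀ {k} (w : Fin k → BVec n) → Injective _≡_ _≡_ w → (∀ j → weight (w j) ≤ 1) →
                   k ≤ suc (weight (⨁ w)) × weight (⨁ w) ≤ k
  weight-⨁-light {zero}  w _     _     = z≤n , ≤-reflexive (weight-𝟘 n)
  weight-⨁-light {suc k} w w-inj light
    rewrite weight-⨁-head w w-inj light = by-head (weight (w zero)) refl (light zero)
    where
    tail-inj : Injective _≡_ _≡_ (w ∘ suc)
    tail-inj = Fin.suc-injective ∘ w-inj
    t = weight (⨁ (w ∘ suc))
    by-head : ∀ h → weight (w zero) ≡ h → h ≤ 1 → suc k ≤ suc (h + t) × h + t ≤ suc k
    by-head 0 w₀≡0 _ = ≤-reflexive (cong suc (sym t≡k)) , ≤-trans (≤-reflexive t≡k) (n≤1+n k)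
      where
      tail-nonzero : ∀ j → weight (w (suc j)) ≢ 0
      tail-nonzero j wj≡0 with () ← w-inj (trans (weight≡0⇒≡𝟘 _ wj≡0) (sym (weight≡0⇒≡𝟘 _ w₀≡0)))
      t≡k : t ≡ k
      t≡k = weight-⨁-units (w ∘ suc) tail-inj λ j → ≤-antisym (light (suc j)) (n≢0⇒n>0 (tail-nonzero j))
    by-head 1 _ _ = let lo , hi = weight-⨁-light (w ∘ suc) tail-inj (light ∘ suc) in s≤s lo , s≤s hi
    by-head (suc (suc _)) _ (s≤s ())

-- The case 𝐠(0) ≠ 0

module TranslatedCase {m n : ℕ} (n≥7 : 7 ≤ n) (m≥6 : 6 ≤ m)
  (u : Fin (suc m) → BVec n) (c : BVec n)
  (u-β : ∀ j → βWeight n (weight (u j)))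
  (pair-β : ∀ {j k} → j ≢ k → βWeight n (weight (c ⊕ u j ⊕ u k)))
  (c-¬β : ¬ βWeight n (weight c)) (c≢𝟘 : weight c ≢ 0) where

  3≤c : 3 ≤ weight c
  3≤c with weight c
  ... | 0                 = ⊥-elim (c≢𝟘 refl)
  ... | 1                 = ⊥-elim (c-¬β one)
  ... | 2                 = ⊥-elim (c-¬β two)
  ... | suc (suc (suc _)) = s≤s (s≤s (s≤s z≤n))

  u-injective : Injective _≡_ _≡_ u
  u-injective {j} {k} uj≡uk with j ≟ k
  ... | yes j≡k = j≡k
  ... | no  j≢k = ⊥-elim (c-¬β (subst (βWeight n ∘ weight)
                    (trans (cong (c ⊕ u j ⊕_) (sym uj≡uk)) ([x⊕y]⊕y≡x c (u j))) (pair-β j≢k)))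

  others : Fin (suc m) → Fin m → BVec n
  others i = u ∘ punchIn i

  others-injective : ∀ i → Injective _≡_ _≡_ (others i)
  others-injective i = punchIn-injective i _ _ ∘ u-injective

  others-β : ∀ i k → βWeight n (weight (c ⊕ u i ⊕ others i k))
  others-β i k = pair-β (punchInᵢ≢i i k ∘ sym)

  no-far : ∀ i → 5 ≤ weight (c ⊕ u i) → ⊥
  no-far i 5≤Y =
    6≰2 (≤-trans m≥6 (injective-into-list⇒≤ (𝟙 ∷ Y ⊕ 𝟙 ∷ []) (others i) (others-injective i) 𝟙-or-complement))
    where
    Y = c ⊕ u i
    𝟙-or-complement : ∀ k → others i k ∈ 𝟙 ∷ Y ⊕ 𝟙 ∷ []
    𝟙-or-complement k with βWeight-cases (u-β (punchIn i k)) | βWeight-cases (others-β i k)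
    ... | inj₂ v≡n | _ = here (weight≡n⇒≡𝟙 _ v≡n)
    ... | _ | inj₂ Y⊕v≡n = there (here (x⊕y≡z⇒y≡x⊕z (weight≡n⇒≡𝟙 (Y ⊕ others i k) Y⊕v≡n)))
    ... | inj₁ (_ , v≤2) | inj₁ (_ , Y⊕v≤2) =
      ⊥-elim (<-irrefl refl (≤-trans 5≤Y (≤-trans (weight-≤-⊕ Y (others i k)) (+-mono-≤ Y⊕v≤2 v≤2))))
    6≰2 : ¬ 6 ≤ 2
    6≰2 (s≤s (s≤s ()))

  others-fill : ∀ i → 3 ≤ weight (c ⊕ u i) → weight (c ⊕ u i) ≤ 4 →
                ∀ {t} → Between (c ⊕ u i) t → ∃ λ k → others i k ≡ t
  others-fill i 3≤Y Y≤4 t-between =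
    let L , |L|≡6 , covers = between-cover (c ⊕ u i) 3≤Y Y≤4
    in  injective-into-list-onto (≡-dec _≟ᴮ_) L (others i) (others-injective i)
          (λ k → covers (between-unless-complement n≥7 (others i k) (≤-trans (s≤s z≤n) 3≤Y) Y≤4
                           (u-β (punchIn i k)) (others-β i k)))
          (subst (_≤ m) (sym |L|≡6) m≥6) (covers t-between)

  no-mid : ∀ i → weight (u i) ≤ 2 → 3 ≤ weight (c ⊕ u i) → weight (c ⊕ u i) ≤ 4 → ⊥
  no-mid i ui≤2 3≤Y Y≤4
    with a , b , a≢b , (Ya , ua) , (Yb , ub) ←
           two-positions-outside (c ⊕ u i) (u i) 3≤Y ui≤2
             (subst (3 ≤_) (cong weight (sym ([x⊕y]⊕y≡x c (u i)))) 3≤c)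
    with t₁ , t₂ , t₁-between , t₂-between , t₁≢t₂ , t₁⊕t₂ ← between-sum 3≤Y Y≤4 a≢b Ya Yb
    with k₁ , k₁↦t₁ ← others-fill i 3≤Y Y≤4 t₁-between
    with k₂ , k₂↦t₂ ← others-fill i 3≤Y Y≤4 t₂-between
    = βWeight-gap 3≤ <n
        (subst (βWeight n ∘ weight) collapse (pair-β (k₁≢k₂ ∘ punchIn-injective i k₁ k₂)))
    where
    open ≡-Reasoning
    k₁≢k₂ : k₁ ≢ k₂
    k₁≢k₂ refl = t₁≢t₂ (trans (sym k₁↦t₁) k₂↦t₂)
    collapse : c ⊕ others i k₁ ⊕ others i k₂ ≡ u i ⊕ (⁅ a ⁆ ⊕ ⁅ b ⁆)
    collapse = begin
      c ⊕ others i k₁ ⊕ others i k₂        ≡⟨ cong₂ (λ x y → c ⊕ x ⊕ y) k₁↦t₁ k₂↦t₂ ⟩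
      c ⊕ t₁ ⊕ t₂                          ≡⟨ ⊕-assoc c t₁ t₂ ⟩
      c ⊕ (t₁ ⊕ t₂)                        ≡⟨ cong (c ⊕_) (trans t₁⊕t₂ (⊕-assoc c (u i) _)) ⟩
      c ⊕ (c ⊕ (u i ⊕ (⁅ a ⁆ ⊕ ⁅ b ⁆)))    ≡⟨ x⊕[x⊕y]≡y c _ ⟩
      u i ⊕ (⁅ a ⁆ ⊕ ⁅ b ⁆)                ∎
    grows : weight (u i ⊕ (⁅ a ⁆ ⊕ ⁅ b ⁆)) ≡ 2 + weight (u i)
    grows = weight-⊕-pair-∉ a≢b (u i) ua ub
    3≤ : 3 ≤ weight (u i ⊕ (⁅ a ⁆ ⊕ ⁅ b ⁆))
    3≤ = subst (3 ≤_) (sym grows) (s≤s (s≤s (βWeight-pos (≤-trans (s≤s z≤n) n≥7) (u-β i))))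
    <n : weight (u i ⊕ (⁅ a ⁆ ⊕ ⁅ b ⁆)) < n
    <n = subst (_< n) (sym grows) (≤-trans (s≤s (s≤s (s≤s ui≤2))) (≤-trans (m≤m+n 5 2) n≥7))

  module _ (near : ∀ j → weight (u j) ≤ 2 → weight (c ⊕ u j) ≤ 2) where

    no-near-𝟙 : ∀ i → u i ≢ 𝟙
    no-near-𝟙 i ui≡𝟙 = complement-gap n≥7 (c ⊕ u j) 1≤c⊕uj (≤-trans (near j uj≤2) (m≤m+n 2 2))
                         (subst (λ v → βWeight n (weight (c ⊕ u j ⊕ v))) ui≡𝟙 (pair-β (punchInᵢ≢i i k)))
      where
      k = fromℕ< (≤-trans (s≤s z≤n) m≥6)
      j = punchIn i k
      uj≤2 : weight (u j) ≤ 2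
      uj≤2 with βWeight-cases (u-β j)
      ... | inj₁ (_ , uj≤2) = uj≤2
      ... | inj₂ uj≡n with () ← punchInᵢ≢i i k (u-injective (trans (weight≡n⇒≡𝟙 (u j) uj≡n) (sym ui≡𝟙)))
      1≤c⊕uj : 1 ≤ weight (c ⊕ u j)
      1≤c⊕uj = n≢0⇒n>0 λ c⊕uj≡0 →
        c-¬β (subst (βWeight n ∘ weight) (sym (x⊕y≡𝟘⇒x≡y (weight≡0⇒≡𝟘 (c ⊕ u j) c⊕uj≡0))) (u-β j))

    no-near : ⊥
    no-near = 7≰6 (subst (suc m ≤_) |L|≡6 (injective-into-list⇒≤ L u u-injective
                                                (λ j → covers (between (light j) (near j (light j))))))
      where
      light : ∀ j → weight (u j) ≤ 2
      light j with βWeight-cases (u-β j)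
      ... | inj₁ (_ , uj≤2) = uj≤2
      ... | inj₂ uj≡n       = ⊥-elim (no-near-𝟙 j (weight≡n⇒≡𝟙 (u j) uj≡n))
      c≤4 : weight c ≤ 4
      c≤4 = ≤-trans (weight-≤-⊕ c (u zero)) (+-mono-≤ (near zero (light zero)) (light zero))
      L      = proj₁ (between-cover c 3≤c c≤4)
      |L|≡6  = proj₁ (proj₂ (between-cover c 3≤c c≤4))
      covers = proj₂ (proj₂ (between-cover c 3≤c c≤4))
      7≰6 : ¬ suc m ≤ 6
      7≰6 m<6 = <-irrefl refl (≤-trans m<6 m≥6)

  impossible : ⊥
  impossible with any? (λ i → weight (u i) ≤? 2 ×-dec 3 ≤? weight (c ⊕ u i))
  ... | no ¬far = no-near λ j uj≤2 → ≤-pred (≰⇒> λ 3≤ → ¬far (j , uj≤2 , 3≤))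
  ... | yes (i , ui≤2 , 3≤Y) with 5 ≤? weight (c ⊕ u i)
  ...   | yes 5≤Y = no-far i 5≤Y
  ...   | no  5≰Y = no-mid i ui≤2 3≤Y (≤-pred (≰⇒> 5≰Y))

translated-case-impossible : ∀ {m n} → 7 ≤ n → 7 ≤ m → (u : Fin m → BVec n) (c : BVec n) →
                             (∀ j → βWeight n (weight (u j))) →
                             (∀ {j k} → j ≢ k → βWeight n (weight (c ⊕ u j ⊕ u k))) →
                             ¬ βWeight n (weight c) → weight c ≢ 0 → ⊥
translated-case-impossible n≥7 (s≤s m≥6) = TranslatedCase.impossible n≥7 m≥6

-- The case 𝐠(0) = 0

odd⇒¬odd-suc : ∀ {m} → Odd m → ¬ Odd (suc m)
odd⇒¬odd-suc {m} m-odd 1+m-odd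
  with () ← trans (sym 1+m-odd) (trans (%-distribˡ-+ 1 m 2) (cong (λ r → (1 + r) % 2) m-odd))

odd-neighbours : ∀ {m n} → Odd m → Odd n → m ≤ suc n → n ≤ suc m → m ≡ n
odd-neighbours {m} {n} m-odd n-odd m≤1+n n≤1+m with <-cmp m n
... | tri≈ _ m≡n _ = m≡n
... | tri< m<n _ _ = ⊥-elim (odd⇒¬odd-suc {m} m-odd (subst Odd (≤-antisym n≤1+m m<n) n-odd))
... | tri> _ _ n<m = ⊥-elim (odd⇒¬odd-suc {n} n-odd (subst Odd (≤-antisym m≤1+n n<m) m-odd))

module LinearCase {m n : ℕ} (n≥7 : 7 ≤ n) (m≥7 : 7 ≤ m)
  (u : Fin m → BVec n)
  (u-β : ∀ j → βWeight n (weight (u j)))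
  (pair-β : ∀ {j k} → j ≢ k → βWeight n (weight (u j ⊕ u k))) where

  1≤n : 1 ≤ n
  1≤n = ≤-trans (s≤s z≤n) n≥7

  u-injective : Injective _≡_ _≡_ u
  u-injective {j} {k} uj≡uk with j ≟ k
  ... | yes j≡k = j≡k
  ... | no  j≢k with () ← βWeight-pos 1≤n (subst (βWeight n) (weight-𝟘 n)
    (subst (βWeight n ∘ weight) (trans (cong (u j ⊕_) (sym uj≡uk)) (⊕-self (u j))) (pair-β j≢k)))

  u-light : ∀ j → weight (u j) ≤ 2
  u-light j with βWeight-cases (u-β j)
  ... | inj₁ (_ , uj≤2) = uj≤2
  ... | inj₂ uj≡n with k , k∉ ← fresh (j ∷ []) (≤-trans (s≤s (s≤s z≤n)) m≥7) with βWeight-cases (u-β k)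
  ...   | inj₂ uk≡n =
    ⊥-elim (k∉ (here (u-injective (trans (weight≡n⇒≡𝟙 (u k) uk≡n) (sym (weight≡n⇒≡𝟙 (u j) uj≡n))))))
  ...   | inj₁ (1≤uk , uk≤2) = ⊥-elim (complement-gap n≥7 (u k) 1≤uk (≤-trans uk≤2 (m≤m+n 2 2))
    (subst (λ v → βWeight n (weight (u k ⊕ v))) (weight≡n⇒≡𝟙 (u j) uj≡n) (pair-β (k∉ ∘ here))))

  pair-close : ∀ {j k} → j ≢ k → weight (u j ⊕ u k) ≤ 2
  pair-close {j} {k} j≢k with βWeight-cases (pair-β j≢k)
  ... | inj₁ (_ , ≤2) = ≤2
  ... | inj₂ ≡n       = ⊥-elim (<-irrefl refl (≤-trans n≥7 (subst (_≤ 6) ≡n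
    (≤-trans (weight-⊕-≤ (u j) (u k)) (≤-trans (+-mono-≤ (u-light j) (u-light k)) (m≤m+n 4 2))))))

  module _ {j₀ a b} (a≢b : a ≢ b) (uj₀≡ab : u j₀ ≡ ⁅ a ⁆ ⊕ ⁅ b ⁆) where

    meets-pair : ∀ j → lookup (u j) a ≡ true ⊎ lookup (u j) b ≡ true
    meets-pair j with lookup (u j) a in ja | lookup (u j) b in jb | j ≟ j₀
    ... | true  | _     | _        = inj₁ refl
    ... | false | true  | _        = inj₂ refl
    ... | false | false | yes refl
      with () ← trans (sym ja) (trans (cong (λ v → lookup v a) uj₀≡ab) (lookup-pair-left a≢b))
    ... | false | false | no  j≢j₀ = ⊥-elim (<-irrefl refl (≤-trans 3≤ (pair-close j≢j₀)))
      where
      3≤ : 3 ≤ weight (u j ⊕ u j₀)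
      3≤ = subst (3 ≤_)
             (sym (trans (cong (λ v → weight (u j ⊕ v)) uj₀≡ab) (weight-⊕-pair-∉ a≢b (u j) ja jb)))
             (s≤s (s≤s (βWeight-pos 1≤n (u-β j))))

    cannot-miss-both : ∀ {k₁ k₂} → lookup (u k₁) a ≡ false → lookup (u k₂) b ≡ false → ⊥
    cannot-miss-both {k₁} {k₂} k₁a k₂b =
      fourth (fresh (j₀ ∷ k₁ ∷ k₂ ∷ []) (≤-trans (s≤s (s≤s (s≤s (s≤s z≤n)))) m≥7))
      where
      other : ∀ {j x y} → lookup (u j) x ≡ false →
              lookup (u j) x ≡ true ⊎ lookup (u j) y ≡ true → lookup (u j) y ≡ true
      other jx (inj₁ jx′) with () ← trans (sym jx) jx′
      other jx (inj₂ jy)  = jy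
      k₁b = other k₁a (meets-pair k₁)
      k₂a = other k₂b (swap (meets-pair k₂))
      separated : ∀ {j k} → j ≢ k → lookup (u j) a ≡ false → lookup (u j) b ≡ true →
                  lookup (u k) a ≡ true → lookup (u k) b ≡ false → u j ⊕ u k ≡ ⁅ a ⁆ ⊕ ⁅ b ⁆
      separated {j} {k} j≢k ja jb ka kb = ≡pair a≢b (u j ⊕ u k) (pair-close j≢k)
        (trans (lookup-⊕ (u j) (u k) a) (cong₂ _xor_ ja ka))
        (trans (lookup-⊕ (u j) (u k) b) (cong₂ _xor_ jb kb))
      k₁≢k₂ : k₁ ≢ k₂
      k₁≢k₂ refl with () ← trans (sym k₁a) k₂a
      fourth : (∃ λ l → l ∉ j₀ ∷ k₁ ∷ k₂ ∷ []) → ⊥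
      fourth (l , l∉) with lookup (u l) a in la | lookup (u l) b in lb
      ... | true  | true  = l∉ (here (u-injective (trans (≡pair a≢b (u l) (u-light l) la lb) (sym uj₀≡ab))))
      ... | true  | false = l∉ (there (there (here (u-injective (⊕-cancelˡ (u k₁)
                              (trans (separated (l∉ ∘ there ∘ here ∘ sym) k₁a k₁b la lb)
                                     (sym (separated k₁≢k₂ k₁a k₁b k₂a k₂b))))))))
      ... | false | true  = l∉ (there (here (u-injective (⊕-cancelʳ (u k₂)
                              (trans (separated (l∉ ∘ there ∘ there ∘ here) la lb k₂a k₂b)
                                     (sym (separated k₁≢k₂ k₁a k₁b k₂a k₂b)))))))
      ... | false | false with meets-pair l
      ...   | inj₁ la′ with () ← trans (sym la) la′
      ...   | inj₂ lb′ with () ← trans (sym lb) lb′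

  missing : ∀ {x} → ¬ (∀ j → lookup (u j) x ≡ true) → ∃ λ k → lookup (u k) x ≡ false
  missing {x} ¬all = let k , k∌x = ¬∀⟶∃¬ m _ (λ j → lookup (u j) x ≟ᴮ true) ¬all in k , ¬-not k∌x

  common-point : ∀ j₀ → weight (u j₀) ≡ 2 → ∃ λ z → ∀ j → lookup (u j) z ≡ true
  common-point j₀ uj₀≡2 with a , b , a≢b , j₀a , j₀b ← two-positions (u j₀) (≤-reflexive (sym uj₀≡2))
    with all? (λ j → lookup (u j) a ≟ᴮ true) | all? (λ j → lookup (u j) b ≟ᴮ true)
  ... | yes all-a  | _          = a , all-a
  ... | no  _      | yes all-b  = b , all-b
  ... | no  ¬all-a | no  ¬all-b = ⊥-elim (cannot-miss-both a≢b (≡pair a≢b (u j₀) (u-light j₀) j₀a j₀b)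
                                            (proj₂ (missing ¬all-a)) (proj₂ (missing ¬all-b)))

  star : ∃ λ z₀ → weight z₀ ≤ 1 × (∀ j → Disjoint z₀ (z₀ ⊕ u j)) × (∀ j → weight (z₀ ⊕ u j) ≤ 1)
  star with any? (λ j → weight (u j) ≟ℕ 2)
  ... | no no-pair = 𝟘 , subst (_≤ 1) (sym (weight-𝟘 n)) z≤n , (λ j → 𝟘-disjoint (𝟘 ⊕ u j)) , light
    where
    light : ∀ j → weight (𝟘 ⊕ u j) ≤ 1
    light j = subst (λ v → weight v ≤ 1) (sym (⊕-identityˡ (u j)))
                (≤-pred (≤∧≢⇒< (u-light j) (no-pair ∘ (j ,_))))
  ... | yes (j₀ , uj₀≡2) = ⁅ z ⁆ , ≤-reflexive (weight-⁅⁆ z) , disjoint , light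
    where
    z = proj₁ (common-point j₀ uj₀≡2)
    all-z = proj₂ (common-point j₀ uj₀≡2)
    disjoint : ∀ j → Disjoint ⁅ z ⁆ (⁅ z ⁆ ⊕ u j)
    disjoint j = ⁅⁆-disjoint (⁅ z ⁆ ⊕ u j)
                   (trans (lookup-⊕ ⁅ z ⁆ (u j) z) (cong₂ _xor_ (lookup-⁅⁆-self z) (all-z j)))
    light : ∀ j → weight (⁅ z ⁆ ⊕ u j) ≤ 1
    light j = ≤-pred (subst (_≤ 2)
                (trans (sym (weight-⊕-⁅⁆-∈ (u j) (all-z j))) (cong (suc ∘ weight) (⊕-comm (u j) ⁅ z ⁆)))
                (u-light j))

  weight-⨁-bounds : m ≤ suc (weight (⨁ u)) × weight (⨁ u) ≤ suc m
  weight-⨁-bounds with z₀ , z₀≤1 , z₀-disjoint , w-light ← star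
    = subst (λ r → m ≤ suc r × r ≤ suc m) (sym split) (≤-trans lo (s≤s (m≤n+m _ _)) , +-mono-≤ Z≤1 hi)
    where
    w : Fin m → BVec n
    w j = z₀ ⊕ u j
    Z = ⨁ {m} (λ _ → z₀)
    lo = proj₁ (weight-⨁-light w (u-injective ∘ ⊕-cancelˡ z₀) w-light)
    hi = proj₂ (weight-⨁-light w (u-injective ∘ ⊕-cancelˡ z₀) w-light)
    Z-parts : (Z ≡ 𝟘 ⊎ Z ≡ z₀) → weight Z ≤ 1 × Disjoint Z (⨁ w)
    Z-parts (inj₁ Z≡𝟘) = subst (λ v → weight v ≤ 1 × Disjoint v (⨁ w)) (sym Z≡𝟘)
                                (subst (_≤ 1) (sym (weight-𝟘 n)) z≤n , 𝟘-disjoint (⨁ w))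
    Z-parts (inj₂ Z≡z₀) = subst (λ v → weight v ≤ 1 × Disjoint v (⨁ w)) (sym Z≡z₀)
                                 (z₀≤1 , disjoint-⨁ z₀ w z₀-disjoint)
    Z≤1 = proj₁ (Z-parts (⨁-const {m} z₀))
    split : weight (⨁ u) ≡ weight Z + weight (⨁ w)
    split = begin
      weight (⨁ u)               ≡⟨ cong weight (⊕-Sum.sum-cong-≗ (λ j → sym (x⊕[x⊕y]≡y z₀ (u j)))) ⟩
      weight (⨁ (λ j → z₀ ⊕ w j)) ≡⟨ cong weight (⊕-Sum.∑-distrib-+ (λ _ → z₀) w) ⟩
      weight (Z ⊕ ⨁ w)           ≡⟨ weight-⊕-disjoint Z (⨁ w) (proj₂ (Z-parts (⨁-const {m} z₀))) ⟩
      weight Z + weight (⨁ w)    ∎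
      where open ≡-Reasoning

  m≡n : Odd m → Odd n → βWeight n (weight (⨁ u)) → m ≡ n
  m≡n m-odd n-odd ⨁u-β with βWeight-cases ⨁u-β
  ... | inj₂ ⨁u≡n       = odd-neighbours m-odd n-odd (subst (λ r → m ≤ suc r) ⨁u≡n (proj₁ weight-⨁-bounds))
                                                    (subst (_≤ suc m) ⨁u≡n (proj₂ weight-⨁-bounds))
  ... | inj₁ (_ , ⨁u≤2) =
    ⊥-elim (<-irrefl refl (≤-trans m≥7 (≤-trans (proj₁ weight-⨁-bounds) (≤-trans (s≤s ⨁u≤2) (m≤m+n 3 3)))))

-- Affine Boolean functions

parity-⊕ : ∀ {n} (x y : BVec n) → parity (x ⊕ y) ≡ parity x xor parity y
parity-⊕ []      []      = refl
parity-⊕ (a ∷ x) (b ∷ y) =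
  trans (cong ((a xor b) xor_) (parity-⊕ x y)) (xor-Properties.interchange a b (parity x) (parity y))

module _ {m : ℕ} (sel : BVec m) where

  parity-∩-⊕ : (x y : BVec m) → parity (sel ∩ (x ⊕ y)) ≡ parity (sel ∩ x) xor parity (sel ∩ y)
  parity-∩-⊕ x y =
    trans (cong parity (zipWith-distribˡ ∧-distribˡ-xor sel x y)) (parity-⊕ (sel ∩ x) (sel ∩ y))

  parity-∩-𝟘 : parity (sel ∩ 𝟘) ≡ false
  parity-∩-𝟘 =
    trans (cong (parity ∘ (sel ∩_)) (sym (⊕-self 𝟘))) (trans (parity-∩-⊕ 𝟘 𝟘) (xor-same (parity (sel ∩ 𝟘))))

InL-⊕ : ∀ {m} {f : BVec m → Bool} → InL f → ∀ x y → f (x ⊕ y) ≡ (f 𝟘 xor f x) xor f y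
InL-⊕ {m} {f} (sel , c , f≡affine) x y = begin
  f (x ⊕ y)                                        ≡⟨ f≡affine (x ⊕ y) ⟩
  c xor ℓ (x ⊕ y)                                  ≡⟨ cong (c xor_) (parity-∩-⊕ sel x y) ⟩
  c xor (ℓ x xor ℓ y)                              ≡⟨ xor-affine c (ℓ x) (ℓ y) ⟩
  ((c xor false) xor (c xor ℓ x)) xor (c xor ℓ y)  ≡⟨ cong (λ b → ((c xor b) xor (c xor ℓ x)) xor (c xor ℓ y))
                                                          (parity-∩-𝟘 sel) ⟨
  ((c xor ℓ 𝟘) xor (c xor ℓ x)) xor (c xor ℓ y)    ≡⟨ cong₂ _xor_ (cong₂ _xor_ (f≡affine 𝟘) (f≡affine x))
                                                                  (f≡affine y) ⟨
  (f 𝟘 xor f x) xor f y                            ∎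
  where
  open ≡-Reasoning
  ℓ : BVec m → Bool
  ℓ v = parity (sel ∩ v)
  xor-affine : ∀ c p q → c xor (p xor q) ≡ ((c xor false) xor (c xor p)) xor (c xor q)
  xor-affine false p     q = refl
  xor-affine true  true  q = refl
  xor-affine true  false q = refl

≤B-true : ∀ {a b} → a ≤B b → a ≡ true → b ≡ true
≤B-true t≤t _  = refl
≤B-true f≤b ()

module AffineMap {m n : ℕ} (g : Fin n → BVec m → Bool) (g∈L : ∀ i → InL (g i))
  (β-mono : ∀ a → β m a ≤B β n (tabulate (λ i → g i a))) where

  G : BVec m → BVec n
  G a = tabulate (λ i → g i a)

  G-lookup : ∀ a i → lookup (G a) i ≡ g i a
  G-lookup a = lookup∘tabulate (λ i → g i a)

  G-⊕ : ∀ x y → G (x ⊕ y) ≡ G 𝟘 ⊕ G x ⊕ G y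
  G-⊕ x y = lookup-ext λ i → begin
    lookup (G (x ⊕ y)) i                                   ≡⟨ G-lookup (x ⊕ y) i ⟩
    g i (x ⊕ y)                                            ≡⟨ InL-⊕ (g∈L i) x y ⟩
    (g i 𝟘 xor g i x) xor g i y                            ≡⟨ cong₂ _xor_ (cong₂ _xor_ (G-lookup 𝟘 i) (G-lookup x i))
                                                                            (G-lookup y i) ⟨
    (lookup (G 𝟘) i xor lookup (G x) i) xor lookup (G y) i ≡⟨ cong (_xor _) (lookup-⊕ (G 𝟘) (G x) i) ⟨
    lookup (G 𝟘 ⊕ G x) i xor lookup (G y) i                ≡⟨ lookup-⊕ (G 𝟘 ⊕ G x) (G y) i ⟨
    lookup (G 𝟘 ⊕ G x ⊕ G y) i                             ∎
    where open ≡-Reasoning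

  G-𝟙 : G 𝟘 ≡ 𝟘 → G 𝟙 ≡ ⨁ (G ∘ ⁅_⁆)
  G-𝟙 G𝟘≡𝟘 = trans (cong G (sym (⨁-⁅⁆ m))) (⨁-homo G G𝟘≡𝟘 additive ⁅_⁆)
    where
    additive : ∀ x y → G (x ⊕ y) ≡ G x ⊕ G y
    additive x y = trans (G-⊕ x y) (cong (_⊕ G y) (trans (cong (_⊕ G x) G𝟘≡𝟘) (⊕-identityˡ (G x))))

  β-image : ∀ a → βWeight m (weight a) → βWeight n (weight (G a))
  β-image a βa = β⇒βWeight (G a) (≤B-true (β-mono a) (βWeight⇒β a βa))

  column-β : ∀ j → βWeight n (weight (G ⁅ j ⁆))
  column-β j = β-image ⁅ j ⁆ (subst (βWeight m) (sym (weight-⁅⁆ j)) one)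

  pair-β : ∀ {j k} → j ≢ k → βWeight n (weight (G 𝟘 ⊕ G ⁅ j ⁆ ⊕ G ⁅ k ⁆))
  pair-β j≢k =
    subst (βWeight n ∘ weight) (G-⊕ _ _) (β-image _ (subst (βWeight m) (sym (weight-pair j≢k)) two))

  linear-pair-β : G 𝟘 ≡ 𝟘 → ∀ {j k} → j ≢ k → βWeight n (weight (G ⁅ j ⁆ ⊕ G ⁅ k ⁆))
  linear-pair-β G𝟘≡𝟘 {j} {k} j≢k = subst (βWeight n ∘ weight)
    (cong (_⊕ G ⁅ k ⁆) (trans (cong (_⊕ G ⁅ j ⁆) G𝟘≡𝟘) (⊕-identityˡ (G ⁅ j ⁆)))) (pair-β j≢k)

  𝟙-β : βWeight n (weight (G 𝟙))
  𝟙-β = β-image 𝟙 (subst (βWeight m) (sym (weight-𝟙 m)) full)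

lemma3p9 : (m n : ℕ) → Odd m → Odd n → 6 < m → 6 < n →
    (g : Fin n → BVec m → Bool) → (∀ i → InL (g i)) →
    β n (tabulate (λ i → g i (replicate m false))) ≡ false →
    (∀ (a : BVec m) → β m a ≤B β n (tabulate (λ i → g i a))) →
    m ≡ n
lemma3p9 m n m-odd n-odd m>6 n>6 g g∈L c∉β β-mono = by-cases (weight (G 𝟘) ≟ℕ 0)
  where
  open AffineMap g g∈L β-mono
  c-¬β : ¬ βWeight n (weight (G 𝟘))
  c-¬β βc with () ← trans (sym c∉β) (βWeight⇒β (G 𝟘) βc)
  by-cases : Dec (weight (G 𝟘) ≡ 0) → m ≡ n
  by-cases (no  c≢𝟘) =
    ⊥-elim (translated-case-impossible n>6 m>6 (G ∘ ⁅_⁆) (G 𝟘) column-β pair-β c-¬β c≢𝟘)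
  by-cases (yes c≡0) = LinearCase.m≡n n>6 m>6 (G ∘ ⁅_⁆) column-β (linear-pair-β c≡𝟘) m-odd n-odd
                         (subst (βWeight n ∘ weight) (G-𝟙 c≡𝟘) 𝟙-β)
    where
    c≡𝟘 = weight≡0⇒≡𝟘 (G 𝟘) c≡0
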